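{- Let $n\geq1$ and let $x_1,\dots,x_n$ be distinct variables. Up to $\mathbf{S5[Con]}$-provable equivalence, the number of formulas of $\mathcal{L}_\Box$ whose variables are among $x_1,\dots,x_n$ is exactly $2^{\left(3^n\, 2^{(3^n-1)}\right)}$.
   Context: $\mathcal{L}_\Box$ is the modal language with a countably infinite set of variables, two one-place predicate symbols $T,F$, and formulas $\varphi::=T(x)\mid F(x)\mid\neg\varphi\mid(\varphi\wedge\varphi)\mid\Box\varphi$; $\vee,\to,\leftrightarrow,\lozenge$ are abbreviations. $\mathbf{S5}$ in this signature is the least set of formulas containing all substitution instances of classical propositional tautologies and all instances of $\Box(A\to B)\to(\Box A\to\Box B)$, $\Box A\to A$, $\lozenge A\to\Box\lozenge A$, closed under modus ponens and necessitation. $\mathbf{S5[Con]}$ additionally has the axioms $\neg(T(y)\wedge F(y))$ for every variable $y$, closed under the same rules. Formulas $\varphi,\psi$ are equivalent if $\mathbf{S5[Con]}\vdash\varphi\leftrightarrow\psi$. -}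

module Defs where

open import Data.Nat using (ℕ; _^_; _*_; _∸_)
open import Data.Bool using (Bool; true; false; not; _∧_)
open import Data.Fin using (Fin)
open import Data.Product using (Σ; ∃; _×_)
open import Relation.Binary.PropositionalEquality using (_≡_)

infixr 6 _∧'_
data Fm : Set where
  T   : ℕ → Fm
  F   : ℕ → Fm
  ¬'_ : Fm → Fm
  _∧'_ : Fm → Fm → Fm
  □_  : Fm → Fm

_∨'_ : Fm → Fm → Fm
A ∨' B = ¬' ((¬' A) ∧' (¬' B))

_⇒_ : Fm → Fm → Fm
A ⇒ B = ¬' (A ∧' (¬' B))

_⇔'_ : Fm → Fm → Fm
A ⇔' B = (A ⇒ B) ∧' (B ⇒ A)

◇_ : Fm → Fm
◇ A = ¬' (□ (¬' A))

data PF : Set where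
  atom : ℕ → PF
  neg  : PF → PF
  conj : PF → PF → PF

evalPF : (ℕ → Bool) → PF → Bool
evalPF v (atom p)   = v p
evalPF v (neg A)    = not (evalPF v A)
evalPF v (conj A B) = evalPF v A ∧ evalPF v B

Tautology : PF → Set
Tautology A = (v : ℕ → Bool) → evalPF v A ≡ true

subst : (ℕ → Fm) → PF → Fm
subst σ (atom p)   = σ p
subst σ (neg A)    = ¬' subst σ A
subst σ (conj A B) = subst σ A ∧' subst σ B

data S5Con : Fm → Set where
  taut : (A : PF) → Tautology A → (σ : ℕ → Fm) → S5Con (subst σ A)
  axK  : (A B : Fm) → S5Con ((□ (A ⇒ B)) ⇒ ((□ A) ⇒ (□ B)))
  axT  : (A : Fm) → S5Con ((□ A) ⇒ A)
  ax5  : (A : Fm) → S5Con ((◇ A) ⇒ (□ (◇ A)))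
  con  : (y : ℕ) → S5Con (¬' (T y ∧' F y))
  mp   : (A B : Fm) → S5Con (A ⇒ B) → S5Con A → S5Con B
  nec  : (A : Fm) → S5Con A → S5Con (□ A)

_≈_ : Fm → Fm → Set
φ ≈ ψ = S5Con (φ ⇔' ψ)

VarsAmong : {n : ℕ} → (Fin n → ℕ) → Fm → Set
VarsAmong x (T y)    = ∃ λ i → x i ≡ y
VarsAmong x (F y)    = ∃ λ i → x i ≡ y
VarsAmong x (¬' A)   = VarsAmong x A
VarsAmong x (A ∧' B) = VarsAmong x A × VarsAmong x B
VarsAmong x (□ A)    = VarsAmong x A

count : ℕ → ℕ
count n = 2 ^ (3 ^ n * 2 ^ (3 ^ n ∸ 1))

{-# OPTIONS --safe #-}
-- Con leaves each variable x i in one of three states (T, F, or neither), so there are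
-- K = 3 ^ n state descriptions α s.  As far as formulas over x can tell, a pointed
-- S5[Con] model is a point (S , s): a cluster S of states with an actual state s ∈ S,
-- and there are K · 2 ^ (K ∸ 1) points.  The characteristic formula
-- χ S s = α s ∧ ⋀ k, ±◇ α k (positive iff k ∈ S) proves each formula over x or its
-- negation, according to the formula's truth value at (S , s), and the χ of all points
-- are provably exhaustive.  So every formula over x is equivalent to the disjunction of
-- the χ of the points where it holds, and by soundness for the points, different sets of
-- points give inequivalent disjunctions: the classes are the 2 ^ (K · 2 ^ (K ∸ 1)) sets
-- of points.
module Submission where

-- Defs declares no fixities for these connectives.
open import Defs renaming
  (_⇒_ to infixr 4 _⇒_; _∨'_ to infixr 5 _∨'_;
   ¬'_ to infixr 9 ¬'_; □_ to infixr 9 □_; ◇_ to infixr 9 ◇_)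

-- Data.Bool's T is renamed So, since T is a predicate symbol of the language.
open import Data.Bool using (Bool; true; false; not; _∧_) renaming (T to So)
open import Data.Bool.Properties using (T-≡; T-not-≡; T-∧)
open import Data.Empty using (⊥-elim)
open import Data.Fin using
  (Fin; zero; suc; fromℕ<; combine; remQuot; quotient; remainder; punchIn; punchOut; finToFun; funToFin)
open import Data.Fin.Patterns using (0F; 1F; 2F)
open import Data.Fin.Properties using
  (2↔Bool; funToFin-finToFin; finToFun-funToFin; combine-remQuot; remQuot-combine; punchIn-punchOut;
   any?; all?; ¬∀⟶∃¬) renaming (_≟_ to _≟ᶠ_)
open import Data.List using (List; []; _∷_; _++_)
open import Data.List.Membership.Propositional using (_∈_)
open import Data.List.Membership.Propositional.Properties using (∈-++⁺ˡ; ∈-++⁺ʳ)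
open import Data.List.Relation.Unary.Any using (here; there)
open import Data.Nat using (ℕ; zero; suc; _≤_; _^_; _*_; _∸_) renaming (_≟_ to _≟ℕ_)
open import Data.Product using (Σ; ∃; _×_; _,_; proj₁; proj₂; uncurry)
open import Data.Vec.Functional using (insertAt; removeAt)
open import Data.Vec.Functional.Properties using
  (insertAt-lookup; insertAt-punchIn; removeAt-punchOut; removeAt-insertAt)
open import Function using (_∘_; Inverse; Equivalence)
open import Function.Definitions using (Injective)
open import Relation.Binary.Definitions using (DecidableEquality)
open import Relation.Binary.PropositionalEquality hiding (subst)
import Relation.Binary.PropositionalEquality as ≡
open import Relation.Nullary using (¬_; Dec; yes; no; contradiction)
open import Relation.Nullary.Decidable using
  (⌊_⌋; map′; _×-dec_; _→-dec_; T?; decidable-stable; toWitness; fromWitness)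

variable
  m n K N y : ℕ
  a b : Bool
  A B C D φ : Fm
  v : Fm → Bool

open Inverse 2↔Bool using () renaming
  (to to toBool; from to fromBool; strictlyInverseˡ to toBool-fromBool; strictlyInverseʳ to fromBool-toBool)

funToFin-cong : {f g : Fin m → Fin n} → f ≗ g → funToFin f ≡ funToFin g
funToFin-cong {zero}  f≗g = refl
funToFin-cong {suc m} f≗g = cong₂ combine (f≗g zero) (funToFin-cong (f≗g ∘ suc))

finToFun-injective : {i j : Fin (m ^ n)} → finToFun {m} {n} i ≗ finToFun j → i ≡ j
finToFun-injective {m} {n} {i} {j} eq =
  trans (sym (funToFin-finToFin {n} {m} i)) (trans (funToFin-cong eq) (funToFin-finToFin {n} {m} j))

bits : Fin (2 ^ N) → Fin N → Bool
bits {N} i = toBool ∘ finToFun {2} {N} i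

bits-injective : {i j : Fin (2 ^ N)} → bits i ≗ bits j → i ≡ j
bits-injective {N} eq = finToFun-injective {2} {N} (toBool-injective ∘ eq)
  where
  toBool-injective : {a b : Fin 2} → toBool a ≡ toBool b → a ≡ b
  toBool-injective {a} {b} e = trans (sym (fromBool-toBool a)) (trans (cong fromBool e) (fromBool-toBool b))

bits-surjective : (X : Fin N → Bool) → ∃ λ i → bits i ≗ X
bits-surjective X = funToFin (fromBool ∘ X) , λ k →
  trans (cong toBool (finToFun-funToFin (fromBool ∘ X) k)) (toBool-fromBool (X k))

-- A point (S , s) with s ∈ S is stored as s together with the bits of S at the other
-- K ∸ 1 elements.
pointed : Fin (suc m) × Fin (2 ^ m) → (Fin (suc m) → Bool) × Fin (suc m)
pointed (s , r) = insertAt (bits r) s true , s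

point : Fin (K * 2 ^ (K ∸ 1)) → (Fin K → Bool) × Fin K
point {suc m} = pointed ∘ remQuot (2 ^ m)

point-∈ : (j : Fin (K * 2 ^ (K ∸ 1))) → So (proj₁ (point {K} j) (proj₂ (point {K} j)))
point-∈ {suc m} j = let (s , r) = remQuot {suc m} (2 ^ m) j in
  ≡.subst So (sym (insertAt-lookup (bits r) s true)) _

point-injective : {i j : Fin (K * 2 ^ (K ∸ 1))} →
  proj₁ (point {K} i) ≗ proj₁ (point {K} j) → proj₂ (point {K} i) ≡ proj₂ (point {K} j) → i ≡ j
point-injective {suc m} {i} {j} S≗ s≡ = begin
  i                                    ≡⟨ combine-remQuot (2 ^ m) i ⟨
  uncurry combine (remQuot (2 ^ m) i)  ≡⟨ cong₂ combine s≡ (bits-injective {m} r≗) ⟩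
  uncurry combine (remQuot (2 ^ m) j)  ≡⟨ combine-remQuot (2 ^ m) j ⟩
  j                                    ∎
  where
  open ≡-Reasoning
  r≗ : bits (remainder (2 ^ m) i) ≗ bits (remainder (2 ^ m) j)
  r≗ k = begin
    bits (remainder (2 ^ m) i) k                      ≡⟨ removeAt-insertAt _ (quotient (2 ^ m) i) true k ⟨
    removeAt (proj₁ (point i)) (quotient (2 ^ m) i) k ≡⟨ S≗ (punchIn _ k) ⟩
    removeAt (proj₁ (point j)) (quotient (2 ^ m) i) k ≡⟨ cong (λ s → removeAt (proj₁ (point j)) s k) s≡ ⟩
    removeAt (proj₁ (point j)) (quotient (2 ^ m) j) k ≡⟨ removeAt-insertAt _ (quotient (2 ^ m) j) true k ⟩
    bits (remainder (2 ^ m) j) k                      ∎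

insertAt-removeAt-∈ : {S : Fin (suc m) → Bool} {s : Fin (suc m)} {xs : Fin m → Bool} →
  So (S s) → xs ≗ removeAt S s → insertAt xs s true ≗ S
insertAt-removeAt-∈ {S = S} {s} {xs} s∈S xs≗ k with s ≟ᶠ k
... | yes refl = trans (insertAt-lookup xs s true) (sym (Equivalence.to T-≡ s∈S))
... | no s≢k = begin
  insertAt xs s true k                          ≡⟨ cong (insertAt xs s true) (punchIn-punchOut s≢k) ⟨
  insertAt xs s true (punchIn s (punchOut s≢k)) ≡⟨ insertAt-punchIn xs s true (punchOut s≢k) ⟩
  xs (punchOut s≢k)                             ≡⟨ xs≗ (punchOut s≢k) ⟩
  removeAt S s (punchOut s≢k)                   ≡⟨ removeAt-punchOut S s≢k ⟩
  S k                                           ∎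
  where open ≡-Reasoning

point-surjective : {S : Fin K → Bool} {s : Fin K} → So (S s) →
  ∃ λ j → proj₁ (point {K} j) ≗ S × proj₂ (point {K} j) ≡ s
point-surjective {suc m} {S} {s} s∈S = combine s r ,
  (λ k → trans (cong (λ p → proj₁ p k) point≡) (insertAt-removeAt-∈ {S = S} s∈S r≗ k)) ,
  cong proj₂ point≡
  where
  r = proj₁ (bits-surjective {m} (removeAt S s))
  r≗ = proj₂ (bits-surjective {m} (removeAt S s))
  point≡ : point (combine s r) ≡ pointed (s , r)
  point≡ = cong pointed (remQuot-combine s r)

So-ext : (So a → So b) → (So b → So a) → a ≡ b
So-ext {false} {false} _   _   = refl
So-ext {false} {true}  _   b⇒a = ⊥-elim (b⇒a _)
So-ext {true}  {false} a⇒b _   = ⊥-elim (a⇒b _)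
So-ext {true}  {true}  _   _   = refl

So-not⁺ : ¬ So b → So (not b)
So-not⁺ {false} _     = _
So-not⁺ {true}  ¬true = ¬true _

So-not⁻ : So (not b) → ¬ So b
So-not⁻ {false} _ ()

⟦_⟧ : Fm → (Fm → Bool) → Bool
⟦ ¬' A ⟧   v = not (⟦ A ⟧ v)
⟦ A ∧' B ⟧ v = ⟦ A ⟧ v ∧ ⟦ B ⟧ v
⟦ φ ⟧      v = v φ

infix 3 _⊨_
record _⊨_ (v : Fm → Bool) (φ : Fm) : Set where
  constructor truth
  field isTrue : So (⟦ φ ⟧ v)
open _⊨_

_⊨?_ : ∀ v φ → Dec (v ⊨ φ)
v ⊨? φ = map′ truth isTrue (T? (⟦ φ ⟧ v))

∧I : v ⊨ A → v ⊨ B → v ⊨ A ∧' B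
∧I (truth a) (truth b) = truth (Equivalence.from T-∧ (a , b))

∧E₁ : v ⊨ A ∧' B → v ⊨ A
∧E₁ (truth ab) = truth (proj₁ (Equivalence.to T-∧ ab))

∧E₂ : v ⊨ A ∧' B → v ⊨ B
∧E₂ (truth ab) = truth (proj₂ (Equivalence.to T-∧ ab))

¬I : ¬ (v ⊨ A) → v ⊨ ¬' A
¬I ¬a = truth (So-not⁺ (¬a ∘ truth))

¬E : v ⊨ ¬' A → ¬ (v ⊨ A)
¬E (truth ¬a) (truth a) = So-not⁻ ¬a a

¬¬E : v ⊨ ¬' ¬' A → v ⊨ A
¬¬E {v} {A} ¬¬a = decidable-stable (v ⊨? A) (¬E ¬¬a ∘ ¬I)

¬¬I : v ⊨ A → v ⊨ ¬' ¬' A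
¬¬I a = ¬I (λ ¬a → ¬E ¬a a)

⇒I : (v ⊨ A → v ⊨ B) → v ⊨ A ⇒ B
⇒I f = ¬I λ a∧¬b → ¬E (∧E₂ a∧¬b) (f (∧E₁ a∧¬b))

⇒E : v ⊨ A ⇒ B → v ⊨ A → v ⊨ B
⇒E a⇒b a = ¬¬E (¬I λ ¬b → ¬E a⇒b (∧I a ¬b))

∨I₁ : v ⊨ A → v ⊨ A ∨' B
∨I₁ a = ¬I λ ¬a∧¬b → ¬E (∧E₁ ¬a∧¬b) a

∨I₂ : v ⊨ B → v ⊨ A ∨' B
∨I₂ b = ¬I λ ¬a∧¬b → ¬E (∧E₂ ¬a∧¬b) b

∨E : {X : Set} → v ⊨ A ∨' B → (v ⊨ A → X) → (v ⊨ B → X) → X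
∨E {v} {A} {B} a∨b f g with v ⊨? A | v ⊨? B
... | yes a | _     = f a
... | no  _ | yes b = g b
... | no ¬a | no ¬b = ⊥-elim (¬E a∨b (∧I (¬I ¬a) (¬I ¬b)))

signed : Bool → Fm → Fm
signed true  A = A
signed false A = ¬' A

⊨-signed⁺ : ⟦ A ⟧ v ≡ b → v ⊨ signed b A
⊨-signed⁺ {b = true}  eq = truth (Equivalence.from T-≡ eq)
⊨-signed⁺ {b = false} eq = truth (Equivalence.from T-not-≡ eq)

⊨-signed⁻ : v ⊨ signed b A → ⟦ A ⟧ v ≡ b
⊨-signed⁻ {b = true}  (truth a) = Equivalence.to T-≡ a
⊨-signed⁻ {b = false} (truth a) = Equivalence.to T-not-≡ a

signed-unique : v ⊨ signed a A → v ⊨ signed b A → a ≡ b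
signed-unique ±a ±b = trans (sym (⊨-signed⁻ ±a)) (⊨-signed⁻ ±b)

signed-So : v ⊨ signed b A → v ⊨ A → So b
signed-So {b = true}  _  _ = _
signed-So {b = false} ¬a a = ⊥-elim (¬E ¬a a)

signed-true : So b → v ⊨ signed b A → v ⊨ A
signed-true {true} _ a = a

signed-false : ¬ So b → v ⊨ signed b A → v ⊨ ¬' A
signed-false {true}  b≢true _ = ⊥-elim (b≢true _)
signed-false {false} _     ¬a = ¬a

infix 4 _≟_
_≟_ : DecidableEquality Fm
T y     ≟ T z     = map′ (cong T) (λ { refl → refl }) (y ≟ℕ z)
F y     ≟ F z     = map′ (cong F) (λ { refl → refl }) (y ≟ℕ z)
¬' A    ≟ ¬' B    = map′ (cong ¬'_) (λ { refl → refl }) (A ≟ B)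
A ∧' B  ≟ C ∧' D  = map′ (uncurry (cong₂ _∧'_)) (λ { refl → refl , refl }) (A ≟ C ×-dec B ≟ D)
□ A     ≟ □ B     = map′ (cong □_) (λ { refl → refl }) (A ≟ B)
T _     ≟ F _     = no λ ()
T _     ≟ ¬' _    = no λ ()
T _     ≟ _ ∧' _  = no λ ()
T _     ≟ □ _     = no λ ()
F _     ≟ T _     = no λ ()
F _     ≟ ¬' _    = no λ ()
F _     ≟ _ ∧' _  = no λ ()
F _     ≟ □ _     = no λ ()
¬' _    ≟ T _     = no λ ()
¬' _    ≟ F _     = no λ ()
¬' _    ≟ _ ∧' _  = no λ ()
¬' _    ≟ □ _     = no λ ()
_ ∧' _  ≟ T _     = no λ ()
_ ∧' _  ≟ F _     = no λ ()
_ ∧' _  ≟ ¬' _    = no λ ()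
_ ∧' _  ≟ □ _     = no λ ()
□ _     ≟ T _     = no λ ()
□ _     ≟ F _     = no λ ()
□ _     ≟ ¬' _    = no λ ()
□ _     ≟ _ ∧' _  = no λ ()

leaves : Fm → List Fm
leaves (¬' A)   = leaves A
leaves (A ∧' B) = leaves A ++ leaves B
leaves φ        = φ ∷ []

indexOf : Fm → List Fm → ℕ
indexOf φ [] = 0
indexOf φ (ψ ∷ L) with φ ≟ ψ
... | yes _ = 0
... | no  _ = suc (indexOf φ L)

infixl 9 _!_
_!_ : List Fm → ℕ → Fm
[]      ! _     = T 0
(ψ ∷ L) ! zero  = ψ
(ψ ∷ L) ! suc i = L ! i

!-indexOf : (L : List Fm) → φ ∈ L → L ! indexOf φ L ≡ φ
!-indexOf {φ} (ψ ∷ L) φ∈ψ∷L with φ ≟ ψ | φ∈ψ∷L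
... | yes φ≡ψ | _         = sym φ≡ψ
... | no  φ≢ψ | here φ≡ψ  = contradiction φ≡ψ φ≢ψ
... | no  _   | there φ∈L = !-indexOf L φ∈L

-- Every leaf (atomic or boxed subformula) becomes the atom numbered by its position in L,
-- so that equal leaves get the same atom.
skeleton : List Fm → Fm → PF
skeleton L (¬' A)   = neg (skeleton L A)
skeleton L (A ∧' B) = conj (skeleton L A) (skeleton L B)
skeleton L φ        = atom (indexOf φ L)

evalPF-skeleton : (w : ℕ → Bool) (L : List Fm) (φ : Fm) →
  evalPF w (skeleton L φ) ≡ ⟦ φ ⟧ (λ ψ → w (indexOf ψ L))
evalPF-skeleton w L (T y)    = refl
evalPF-skeleton w L (F y)    = refl
evalPF-skeleton w L (¬' A)   = cong not (evalPF-skeleton w L A)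
evalPF-skeleton w L (A ∧' B) = cong₂ _∧_ (evalPF-skeleton w L A) (evalPF-skeleton w L B)
evalPF-skeleton w L (□ A)    = refl

subst-skeleton : (L : List Fm) (φ : Fm) → (∀ {ψ} → ψ ∈ leaves φ → ψ ∈ L) →
  subst (L !_) (skeleton L φ) ≡ φ
subst-skeleton L (T y)    ⊆L = !-indexOf L (⊆L (here refl))
subst-skeleton L (F y)    ⊆L = !-indexOf L (⊆L (here refl))
subst-skeleton L (¬' A)   ⊆L = cong ¬'_ (subst-skeleton L A ⊆L)
subst-skeleton L (A ∧' B) ⊆L =
  cong₂ _∧'_ (subst-skeleton L A (⊆L ∘ ∈-++⁺ˡ)) (subst-skeleton L B (⊆L ∘ ∈-++⁺ʳ (leaves A)))
subst-skeleton L (□ A)    ⊆L = !-indexOf L (⊆L (here refl))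

tautology : (∀ {v} → v ⊨ φ) → S5Con φ
tautology {φ} valid =
  ≡.subst S5Con (subst-skeleton L φ λ ψ∈L → ψ∈L) (taut (skeleton L φ) skeleton-taut (L !_))
  where
  L = leaves φ
  skeleton-taut : Tautology (skeleton L φ)
  skeleton-taut w = trans (evalPF-skeleton w L φ) (Equivalence.to T-≡ (isTrue valid))

⟦⟧-subst : (A : PF) (σ : ℕ → Fm) → ⟦ subst σ A ⟧ v ≡ evalPF (λ p → ⟦ σ p ⟧ v) A
⟦⟧-subst (atom p)   σ = refl
⟦⟧-subst (neg A)    σ = cong not (⟦⟧-subst A σ)
⟦⟧-subst (conj A B) σ = cong₂ _∧_ (⟦⟧-subst A σ) (⟦⟧-subst B σ)

tautology-valid : (A : PF) → Tautology A → (σ : ℕ → Fm) → v ⊨ subst σ A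
tautology-valid A taut-A σ = truth (Equivalence.from T-≡ (trans (⟦⟧-subst A σ) (taut-A _)))

taut-mp : S5Con A → (∀ {v} → v ⊨ A → v ⊨ B) → S5Con B
taut-mp {A} {B} ⊢A A⊨B = mp A B (tautology (⇒I A⊨B)) ⊢A

∧-⊢ : S5Con A → S5Con B → S5Con (A ∧' B)
∧-⊢ ⊢A ⊢B = mp _ _ (taut-mp ⊢A λ a → ⇒I λ b → ∧I a b) ⊢B

taut-mp₂ : S5Con A → S5Con B → (∀ {v} → v ⊨ A → v ⊨ B → v ⊨ C) → S5Con C
taut-mp₂ ⊢A ⊢B f = taut-mp (∧-⊢ ⊢A ⊢B) λ a∧b → f (∧E₁ a∧b) (∧E₂ a∧b)

⇒-trans : S5Con (A ⇒ B) → S5Con (B ⇒ C) → S5Con (A ⇒ C)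
⇒-trans ⊢A⇒B ⊢B⇒C = taut-mp₂ ⊢A⇒B ⊢B⇒C λ a⇒b b⇒c → ⇒I (⇒E b⇒c ∘ ⇒E a⇒b)

⇒-map : S5Con (C ⇒ A) → (∀ {v} → v ⊨ A → v ⊨ B) → S5Con (C ⇒ B)
⇒-map ⊢C⇒A f = taut-mp ⊢C⇒A λ c⇒a → ⇒I (f ∘ ⇒E c⇒a)

⇒-map₂ : S5Con (C ⇒ A) → S5Con (C ⇒ B) → (∀ {v} → v ⊨ A → v ⊨ B → v ⊨ D) → S5Con (C ⇒ D)
⇒-map₂ ⊢C⇒A ⊢C⇒B f =
  taut-mp₂ ⊢C⇒A ⊢C⇒B λ c⇒a c⇒b → ⇒I λ c → f (⇒E c⇒a c) (⇒E c⇒b c)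

contrapose : S5Con (A ⇒ B) → S5Con (¬' B ⇒ ¬' A)
contrapose ⊢A⇒B = taut-mp ⊢A⇒B λ a⇒b → ⇒I λ ¬b → ¬I (¬E ¬b ∘ ⇒E a⇒b)

□-mono : S5Con (A ⇒ B) → S5Con (□ A ⇒ □ B)
□-mono {A} {B} ⊢A⇒B = mp _ _ (axK A B) (nec _ ⊢A⇒B)

□-∧ : S5Con (□ A ∧' □ B ⇒ □ (A ∧' B))
□-∧ {A} {B} =
  taut-mp₂ (□-mono {A} {B ⇒ A ∧' B} (tautology (⇒I λ a → ⇒I λ b → ∧I a b))) (axK B (A ∧' B))
    λ □a⇒□[b⇒ab] □[b⇒ab]⇒□b⇒□ab → ⇒I λ □a∧□b →
      ⇒E (⇒E □[b⇒ab]⇒□b⇒□ab (⇒E □a⇒□[b⇒ab] (∧E₁ □a∧□b))) (∧E₂ □a∧□b)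

□-map₂ : S5Con (C ⇒ □ A) → S5Con (C ⇒ □ B) → (∀ {v} → v ⊨ A → v ⊨ B → v ⊨ D) →
  S5Con (C ⇒ □ D)
□-map₂ ⊢C⇒□A ⊢C⇒□B f = ⇒-trans (⇒-map₂ ⊢C⇒□A ⊢C⇒□B ∧I)
  (⇒-trans □-∧ (□-mono (tautology (⇒I λ a∧b → f (∧E₁ a∧b) (∧E₂ a∧b)))))

◇-mono : S5Con (A ⇒ B) → S5Con (◇ A ⇒ ◇ B)
◇-mono = contrapose ∘ □-mono ∘ contrapose

◇¬⇒¬□ : S5Con (◇ ¬' A ⇒ ¬' □ A)
◇¬⇒¬□ = contrapose (□-mono (tautology (⇒I ¬¬I)))

axB : S5Con (A ⇒ □ ◇ A)
axB {A} = taut-mp₂ (axT (¬' A)) (ax5 A) λ □¬a⇒¬a ◇a⇒□◇a → ⇒I λ a →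
  ⇒E ◇a⇒□◇a (¬I λ □¬a → ¬E (⇒E □¬a⇒¬a □¬a) a)

◇□⇒□ : S5Con (◇ □ A ⇒ □ A)
◇□⇒□ {A} =
  taut-mp₂ (contrapose (□-mono (tautology (⇒I ¬¬E)))) (⇒-trans (ax5 (¬' A)) (□-mono ◇¬⇒¬□))
    λ ¬□a⇒◇¬a ◇¬a⇒□¬□a → ⇒I λ ◇□a →
      ¬¬E (¬I λ ¬□a → ¬E ◇□a (⇒E ◇¬a⇒□¬□a (⇒E ¬□a⇒◇¬a ¬□a)))

ax4 : S5Con (□ A ⇒ □ □ A)
ax4 = ⇒-trans axB (□-mono ◇□⇒□)

◇-∧-□ : S5Con (◇ A ∧' □ B ⇒ ◇ (A ∧' B))
◇-∧-□ {A} {B} =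
  taut-mp₂
    (□-mono {B} {¬' (A ∧' B) ⇒ ¬' A} (tautology (⇒I λ b → ⇒I λ ¬ab → ¬I λ a → ¬E ¬ab (∧I a b))))
    (axK (¬' (A ∧' B)) (¬' A)) λ □b⇒□[¬ab⇒¬a] K → ⇒I λ ◇a∧□b → ¬I λ □¬ab →
      ¬E (∧E₁ ◇a∧□b) (⇒E (⇒E K (⇒E □b⇒□[¬ab⇒¬a] (∧E₂ ◇a∧□b))) □¬ab)

signed-◇-necessary : (b : Bool) → S5Con (signed b (◇ A) ⇒ □ signed b (◇ A))
signed-◇-necessary {A} true  = ax5 A
signed-◇-necessary     false =
  ⇒-trans (tautology (⇒I ¬¬E)) (⇒-trans ax4 (□-mono (tautology (⇒I ¬¬I))))

-- The language has no constants, so ⊥ is written with a variable y₀.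
module Connectives (y₀ : ℕ) where

  ⊥' : Fm
  ⊥' = T y₀ ∧' ¬' T y₀

  ⊭⊥' : ¬ (v ⊨ ⊥')
  ⊭⊥' t∧¬t = ¬E (∧E₂ t∧¬t) (∧E₁ t∧¬t)

  ⋀ ⋁ : (Fin m → Fm) → Fm
  ⋀ {zero}  g = ¬' ⊥'
  ⋀ {suc m} g = g zero ∧' ⋀ (g ∘ suc)
  ⋁ {zero}  g = ⊥'
  ⋁ {suc m} g = g zero ∨' ⋁ (g ∘ suc)

  ⋀I : {g : Fin m → Fm} → (∀ i → v ⊨ g i) → v ⊨ ⋀ g
  ⋀I {zero}  _   = ¬I ⊭⊥'
  ⋀I {suc m} all = ∧I (all zero) (⋀I (all ∘ suc))

  ⋀E : {g : Fin m → Fm} → v ⊨ ⋀ g → ∀ i → v ⊨ g i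
  ⋀E {suc m} all zero    = ∧E₁ all
  ⋀E {suc m} all (suc i) = ⋀E (∧E₂ all) i

  ⋁I : {g : Fin m → Fm} → ∀ i → v ⊨ g i → v ⊨ ⋁ g
  ⋁I {suc m} zero    gi = ∨I₁ gi
  ⋁I {suc m} (suc i) gi = ∨I₂ (⋁I i gi)

  ⋁E : {g : Fin m → Fm} → v ⊨ ⋁ g → ∃ λ i → v ⊨ g i
  ⋁E {zero}  absurd = ⊥-elim (⊭⊥' absurd)
  ⋁E {suc m} some   = ∨E some (zero ,_) λ rest → let (i , gi) = ⋁E rest in suc i , gi

  ⋀-⊢ : {g : Fin m → Fm} → (∀ i → S5Con (g i)) → S5Con (⋀ g)
  ⋀-⊢ {zero}  _   = tautology (¬I ⊭⊥')
  ⋀-⊢ {suc m} all = ∧-⊢ (all zero) (⋀-⊢ (all ∘ suc))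

  ⋀-⇒ : {g : Fin m → Fm} → (∀ i → S5Con (C ⇒ g i)) → S5Con (C ⇒ ⋀ g)
  ⋀-⇒ all = taut-mp (⋀-⊢ all) λ all⊨ → ⇒I λ c → ⋀I λ i → ⇒E (⋀E all⊨ i) c

  ⋀-□ : {g : Fin m → Fm} → (∀ i → S5Con (C ⇒ □ g i)) → S5Con (C ⇒ □ ⋀ g)
  ⋀-□ {zero}  _   = taut-mp (nec _ (tautology (¬I ⊭⊥'))) λ □⊤ → ⇒I λ _ → □⊤
  ⋀-□ {suc m} all = □-map₂ (all zero) (⋀-□ (all ∘ suc)) ∧I

  _when_ : Fm → Bool → Fm
  A when true  = A
  A when false = ⊥'

  ⋁⟨_⟩ : (Fin m → Bool) → (Fin m → Fm) → Fm
  ⋁⟨ X ⟩ g = ⋁ λ j → g j when X j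

  ⋁⟨⟩I : {X : Fin m → Bool} {g : Fin m → Fm} → ∀ j → So (X j) → v ⊨ g j → v ⊨ ⋁⟨ X ⟩ g
  ⋁⟨⟩I {X = X} j Xj gj = ⋁I j (when-true (X j) Xj gj)
    where
    when-true : ∀ b → So b → v ⊨ A → v ⊨ A when b
    when-true true _ a = a

  ⋁⟨⟩E : {X : Fin m → Bool} {g : Fin m → Fm} → v ⊨ ⋁⟨ X ⟩ g → ∃ λ j → So (X j) × v ⊨ g j
  ⋁⟨⟩E {X = X} some = let (j , gj) = ⋁E some in j , when-elim (X j) gj
    where
    when-elim : ∀ b → v ⊨ A when b → So b × v ⊨ A
    when-elim true  a      = _ , a
    when-elim false absurd = ⊥-elim (⊭⊥' absurd)

  ⋁⟨⟩-≈ : {X : Fin m → Bool} {g : Fin m → Fm} →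
    S5Con (⋁ g) → (∀ j → S5Con (g j ⇒ signed (X j) φ)) → φ ≈ ⋁⟨ X ⟩ g
  ⋁⟨⟩-≈ {X = X} {g} ⊢⋁g g⇒±φ = taut-mp₂ ⊢⋁g (⋀-⊢ g⇒±φ) λ some all →
    ∧I (⇒I λ holds → let (j , gj) = ⋁E some in
          ⋁⟨⟩I {X = X} j (signed-So (⇒E (⋀E all j) gj) holds) gj)
       (⇒I λ sel → let (j , Xj , gj) = ⋁⟨⟩E {X = X} {g} sel in signed-true Xj (⇒E (⋀E all j) gj))

isT isF : Fin 3 → Bool
isT 0F = true
isT _  = false
isF 1F = true
isF _  = false

stateOf : Bool → Bool → Fin 3
stateOf true  _     = 0F
stateOf false true  = 1F
stateOf false false = 2F

stateOf-isT-isF : (d : Fin 3) → stateOf (isT d) (isF d) ≡ d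
stateOf-isT-isF 0F = refl
stateOf-isT-isF 1F = refl
stateOf-isT-isF 2F = refl

isT-stateOf : (a b : Bool) → isT (stateOf a b) ≡ a
isT-stateOf true  _     = refl
isT-stateOf false true  = refl
isT-stateOf false false = refl

isF-stateOf : (a b : Bool) → ¬ (So a × So b) → isF (stateOf a b) ≡ b
isF-stateOf true  true  ¬both = ⊥-elim (¬both _)
isF-stateOf true  false _     = refl
isF-stateOf false true  _     = refl
isF-stateOf false false _     = refl

isT-isF-disjoint : (d : Fin 3) → ¬ (So (isT d) × So (isF d))
isT-isF-disjoint 0F ()
isT-isF-disjoint 1F ()
isT-isF-disjoint 2F ()

-- ⊥' is written with x i₀, so that the normal forms only use the variables x; this is
-- where n ≥ 1 is needed.
module Model {n : ℕ} (x : Fin n → ℕ) (x-injective : Injective _≡_ _≡_ x) (i₀ : Fin n) where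
  open Connectives (x i₀)

  -- State s makes x i true (0F), false (1F) or neither (2F) according to digits s i.
  digits : Fin (3 ^ n) → Fin n → Fin 3
  digits = finToFun {3} {n}

  -- Derivations may use variables outside x, so soundness needs them interpreted too.
  value : (Fin n → Fin 3) → ℕ → Fin 3
  value d y with any? (λ i → x i ≟ℕ y)
  ... | yes (i , _) = d i
  ... | no  _       = 2F

  value-x : (d : Fin n → Fin 3) (i : Fin n) → value d (x i) ≡ d i
  value-x d i with any? (λ j → x j ≟ℕ x i)
  ... | yes (j , xj≡xi) = cong d (x-injective xj≡xi)
  ... | no  ∄j          = contradiction (i , refl) ∄j

  world : (Fin (3 ^ n) → Bool) → Fin (3 ^ n) → Fm → Bool
  world S s (T y)    = isT (value (digits s) y)
  world S s (F y)    = isF (value (digits s) y)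
  world S s (¬' A)   = not (world S s A)
  world S s (A ∧' B) = world S s A ∧ world S s B
  world S s (□ A)    = ⌊ all? (λ k → T? (S k) →-dec T? (world S k A)) ⌋

  ⟦⟧-world : (S : Fin (3 ^ n) → Bool) (s : Fin (3 ^ n)) (φ : Fm) → ⟦ φ ⟧ (world S s) ≡ world S s φ
  ⟦⟧-world S s (T y)    = refl
  ⟦⟧-world S s (F y)    = refl
  ⟦⟧-world S s (¬' A)   = cong not (⟦⟧-world S s A)
  ⟦⟧-world S s (A ∧' B) = cong₂ _∧_ (⟦⟧-world S s A) (⟦⟧-world S s B)
  ⟦⟧-world S s (□ A)    = refl

  variable
    S S′ : Fin (3 ^ n) → Bool
    s s′ k : Fin (3 ^ n)

  world-□I : (∀ {k} → So (S k) → world S k ⊨ A) → world S s ⊨ □ A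
  world-□I {S} {A} all =
    truth (fromWitness λ k k∈S → ≡.subst So (⟦⟧-world S k A) (isTrue (all k∈S)))

  world-□E : world S s ⊨ □ A → So (S k) → world S k ⊨ A
  world-□E {S} {A = A} {k = k} (truth □a) k∈S =
    truth (≡.subst So (sym (⟦⟧-world S k A)) (toWitness □a k k∈S))

  world-¬□E : world S s ⊨ ¬' □ A → ∃ λ k → So (S k) × world S k ⊨ ¬' A
  world-¬□E {S} {A = A} ¬□a =
    let (k , ¬[k∈S⇒a]) =
          ¬∀⟶∃¬ (3 ^ n) _ (λ k → T? (S k) →-dec T? (world S k A)) (¬E ¬□a ∘ □a)
    in k , decidable-stable (T? (S k)) (λ k∉S → ¬[k∈S⇒a] (⊥-elim ∘ k∉S)) ,
       ¬I λ a → ¬[k∈S⇒a] λ _ → ≡.subst So (⟦⟧-world S k A) (isTrue a)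
    where
    □a : (∀ k → So (S k) → So (world S k A)) → world S _ ⊨ □ A
    □a all = truth (fromWitness all)

  world-◇I : So (S k) → world S k ⊨ A → world S s ⊨ ◇ A
  world-◇I k∈S a = ¬I λ □¬a → ¬E (world-□E □¬a k∈S) a

  world-◇E : world S s ⊨ ◇ A → ∃ λ k → So (S k) × world S k ⊨ A
  world-◇E ◇a = let (k , k∈S , ¬¬a) = world-¬□E ◇a in k , k∈S , ¬¬E ¬¬a

  sound : S5Con φ → So (S s) → world S s ⊨ φ
  sound (taut A taut-A σ) _ = tautology-valid A taut-A σ
  sound (axK A B) _ = ⇒I λ □[a⇒b] → ⇒I λ □a →
    world-□I λ k∈S → ⇒E (world-□E □[a⇒b] k∈S) (world-□E □a k∈S)
  sound (axT A) s∈S = ⇒I λ □a → world-□E □a s∈S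
  -- The truth value of ◇ A is the same at every world of S.
  sound (ax5 A) _ = ⇒I λ ◇a → world-□I λ _ → truth (isTrue ◇a)
  sound (con y) _ = ¬I λ t∧f → isT-isF-disjoint _ (isTrue (∧E₁ t∧f) , isTrue (∧E₂ t∧f))
  sound (mp A B p q) s∈S = ⇒E (sound p s∈S) (sound q s∈S)
  sound (nec A p) _ = world-□I (sound p)

  lit : Fin 3 → ℕ → Fm
  lit d y = signed (isT d) (T y) ∧' signed (isF d) (F y)

  α : Fin (3 ^ n) → Fm
  α s = ⋀ λ i → lit (digits s i) (x i)

  β : (Fin (3 ^ n) → Bool) → Fm
  β S = ⋀ λ k → signed (S k) (◇ α k)

  χ : (Fin (3 ^ n) → Bool) → Fin (3 ^ n) → Fm
  χ S s = α s ∧' β S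

  α-self : world S s ⊨ α s
  α-self {s = s} = ⋀I λ i →
    ∧I (⊨-signed⁺ (cong isT (value-x (digits s) i))) (⊨-signed⁺ (cong isF (value-x (digits s) i)))

  α-unique : world S s ⊨ α s′ → s ≡ s′
  α-unique {s = s} {s′} αs′ = finToFun-injective {3} {n} λ i →
    let lit-i = ⋀E αs′ i
        T-eq = trans (sym (cong isT (value-x (digits s) i))) (⊨-signed⁻ (∧E₁ lit-i))
        F-eq = trans (sym (cong isF (value-x (digits s) i))) (⊨-signed⁻ (∧E₂ lit-i))
    in trans (sym (stateOf-isT-isF _)) (trans (cong₂ stateOf T-eq F-eq) (stateOf-isT-isF _))

  ◇α-world : ⟦ ◇ α k ⟧ (world S s) ≡ S k
  ◇α-world {k} {S} {s} = So-ext
    (λ ◇αk → let (k′ , k′∈S , αk) = world-◇E {S} {s} {α k} (truth ◇αk) in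
      ≡.subst (So ∘ S) (α-unique αk) k′∈S)
    (λ k∈S → isTrue (world-◇I {S} {k} {α k} {s} k∈S α-self))

  β-self : world S s ⊨ β S
  β-self {S} {s} = ⋀I λ k → ⊨-signed⁺ (◇α-world {k} {S} {s})

  β-unique : world S s ⊨ β S′ → S ≗ S′
  β-unique {S} {s} βS′ k = trans (sym (◇α-world {k} {S} {s})) (⊨-signed⁻ (⋀E βS′ k))

  χ-self : world S s ⊨ χ S s
  χ-self = ∧I α-self β-self

  χ-unique : world S s ⊨ χ S′ s′ → S ≗ S′ × s ≡ s′
  χ-unique χ′ = β-unique (∧E₂ χ′) , α-unique (∧E₁ χ′)

  lit-stateOf : v ⊨ ¬' (T y ∧' F y) → v ⊨ lit (stateOf (v (T y)) (v (F y))) y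
  lit-stateOf {v} {y} con-y = ∧I
    (⊨-signed⁺ (sym (isT-stateOf (v (T y)) (v (F y)))))
    (⊨-signed⁺ (sym (isF-stateOf (v (T y)) (v (F y)) λ (t , f) → ¬E con-y (∧I (truth t) (truth f)))))

  α-exhaustive : S5Con (⋁ α)
  α-exhaustive = taut-mp (⋀-⊢ λ i → con (x i)) λ {v} cons →
    let d i = stateOf (v (T (x i))) (v (F (x i)))
    in ⋁I (funToFin d) (⋀I λ i →
         ≡.subst (λ e → v ⊨ lit e (x i)) (sym (finToFun-funToFin d i)) (lit-stateOf (⋀E cons i)))

  β-necessary : S5Con (β S ⇒ □ β S)
  β-necessary {S} = ⋀-□ λ k → ⇒-trans (tautology (⇒I λ βS → ⋀E βS k)) (signed-◇-necessary (S k))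

  β-⇒-α⇒ : (∀ {k} → So (S k) → S5Con (χ S k ⇒ A)) → ∀ k → S5Con (β S ⇒ α k ⇒ A)
  β-⇒-α⇒ {S} {A} χ⇒A k with T? (S k)
  ... | yes k∈S = taut-mp (χ⇒A k∈S) λ χ⇒a → ⇒I λ βS → ⇒I λ αk → ⇒E χ⇒a (∧I αk βS)
  ... | no  k∉S = taut-mp (axT (¬' α k)) λ □¬α⇒¬α → ⇒I λ βS → ⇒I λ αk →
    ⊥-elim (¬E (⇒E □¬α⇒¬α (¬¬E (signed-false k∉S (⋀E βS k)))) αk)

  χ-entails-□ : (∀ {k} → So (S k) → S5Con (χ S k ⇒ A)) → S5Con (χ S s ⇒ □ A)
  χ-entails-□ χ⇒A = □-map₂
    (⇒-trans (tautology (⇒I ∧E₂)) (⇒-trans β-necessary (□-mono (⋀-⇒ (β-⇒-α⇒ χ⇒A)))))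
    (taut-mp (nec _ α-exhaustive) λ □⋁α → ⇒I λ _ → □⋁α)
    λ all some → let (k , αk) = ⋁E some in ⇒E (⋀E all k) αk

  χ-refutes-□ : So (S k) → S5Con (χ S k ⇒ ¬' A) → S5Con (χ S s ⇒ ¬' □ A)
  χ-refutes-□ {S} {k} k∈S χ⇒¬A =
    ⇒-trans (⇒-map₂ (tautology (⇒I λ χ → signed-true k∈S (⋀E (∧E₂ χ) k)))
                    (⇒-trans (tautology (⇒I ∧E₂)) β-necessary) ∧I)
      (⇒-trans ◇-∧-□ (⇒-trans (◇-mono χ⇒¬A) ◇¬⇒¬□))

  χ-entails : (b : Bool) (φ : Fm) → VarsAmong x φ →
    world S s ⊨ signed b φ → S5Con (χ S s ⇒ signed b φ)
  χ-entails {S} {s} b (T _) (i , refl) t =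
    ≡.subst (λ c → S5Con (χ S s ⇒ signed c (T (x i)))) (signed-unique (∧E₁ (⋀E (α-self {S}) i)) t)
      (tautology (⇒I λ χ → ∧E₁ (⋀E (∧E₁ χ) i)))
  χ-entails {S} {s} b (F _) (i , refl) f =
    ≡.subst (λ c → S5Con (χ S s ⇒ signed c (F (x i)))) (signed-unique (∧E₂ (⋀E (α-self {S}) i)) f)
      (tautology (⇒I λ χ → ∧E₂ (⋀E (∧E₁ χ) i)))
  χ-entails true  (¬' A) va ¬a  = χ-entails false A va ¬a
  χ-entails false (¬' A) va ¬¬a = ⇒-map (χ-entails true A va (¬¬E ¬¬a)) ¬¬I
  χ-entails true  (A ∧' B) (va , vb) a∧b =
    ⇒-map₂ (χ-entails true A va (∧E₁ a∧b)) (χ-entails true B vb (∧E₂ a∧b)) ∧I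
  χ-entails {S} {s} false (A ∧' B) (va , vb) ¬[a∧b] with world S s ⊨? A
  ... | yes a =
    ⇒-map (χ-entails false B vb (¬I λ b → ¬E ¬[a∧b] (∧I a b))) λ ¬b → ¬I (¬E ¬b ∘ ∧E₂)
  ... | no ¬a = ⇒-map (χ-entails false A va (¬I ¬a)) λ ¬a → ¬I (¬E ¬a ∘ ∧E₁)
  χ-entails true  (□ A) va □a  = χ-entails-□ λ k∈S → χ-entails true A va (world-□E □a k∈S)
  χ-entails false (□ A) va ¬□a =
    let (k , k∈S , ¬a) = world-¬□E ¬□a in χ-refutes-□ k∈S (χ-entails false A va ¬a)

  pointCount : ℕ
  pointCount = 3 ^ n * 2 ^ (3 ^ n ∸ 1)

  χ-point : Fin pointCount → Fm
  χ-point j = uncurry χ (point {3 ^ n} j)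

  at : Fin pointCount → Fm → Bool
  at j = uncurry world (point {3 ^ n} j)

  -- A valuation satisfying Con and the T axioms satisfies χ S s, where α s is the state it
  -- satisfies and S k is its value of ◇ α k.
  χ-points-exhaustive : S5Con (⋁ χ-point)
  χ-points-exhaustive = taut-mp₂ α-exhaustive (⋀-⊢ λ s → axT (¬' α s)) λ {v} some □¬α⇒¬α →
    let (s , αs) = ⋁E some
        s∈◇ : So (⟦ ◇ α s ⟧ v)
        s∈◇ = isTrue (¬I λ □¬αs → ¬E (⇒E (⋀E □¬α⇒¬α s) □¬αs) αs)
        (j , S≗ , s≡) = point-surjective {S = λ k → ⟦ ◇ α k ⟧ v} s∈◇
    in ⋁I j (∧I (≡.subst (λ t → v ⊨ α t) (sym s≡) αs) (⋀I λ k → ⊨-signed⁺ (sym (S≗ k))))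

  normalForm : Fin (2 ^ pointCount) → Fm
  normalForm i = ⋁⟨ bits i ⟩ χ-point

  normalForm-at⁺ : {i : Fin (2 ^ pointCount)} {j : Fin pointCount} → So (bits i j) → at j ⊨ normalForm i
  normalForm-at⁺ {i} {j} j∈i = ⋁⟨⟩I {X = bits i} {g = χ-point} j j∈i χ-self

  normalForm-at⁻ : {i : Fin (2 ^ pointCount)} {j : Fin pointCount} → at j ⊨ normalForm i → So (bits i j)
  normalForm-at⁻ {i} {j} nf =
    let (j′ , j′∈i , χj′) = ⋁⟨⟩E {X = bits i} nf
        (S≗ , s≡) = χ-unique χj′
    in ≡.subst (So ∘ bits i) (sym (point-injective S≗ s≡)) j′∈i

  normalForm-injective : ∀ i i′ → normalForm i ≈ normalForm i′ → i ≡ i′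
  normalForm-injective i i′ i≈i′ = bits-injective {pointCount} λ j →
    let ⇔ = sound i≈i′ (point-∈ {3 ^ n} j)
    in So-ext (normalForm-at⁻ ∘ ⇒E (∧E₁ ⇔) ∘ normalForm-at⁺)
              (normalForm-at⁻ ∘ ⇒E (∧E₂ ⇔) ∘ normalForm-at⁺)

  normalForm-complete : (φ : Fm) → VarsAmong x φ → ∃ λ i → φ ≈ normalForm i
  normalForm-complete φ va with bits-surjective {pointCount} (λ j → ⟦ φ ⟧ (at j))
  ... | i , i≗φ = i , ⋁⟨⟩-≈ χ-points-exhaustive λ j →
    ≡.subst (λ b → S5Con (χ-point j ⇒ signed b φ)) (sym (i≗φ j))
      (χ-entails _ φ va (⊨-signed⁺ {A = φ} refl))

  vars-⊥' : VarsAmong x ⊥'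
  vars-⊥' = (i₀ , refl) , (i₀ , refl)

  vars-⋀ : {g : Fin m → Fm} → (∀ i → VarsAmong x (g i)) → VarsAmong x (⋀ g)
  vars-⋀ {zero}  _    = vars-⊥'
  vars-⋀ {suc m} vars = vars zero , vars-⋀ (vars ∘ suc)

  vars-⋁ : {g : Fin m → Fm} → (∀ i → VarsAmong x (g i)) → VarsAmong x (⋁ g)
  vars-⋁ {zero}  _    = vars-⊥'
  vars-⋁ {suc m} vars = vars zero , vars-⋁ (vars ∘ suc)

  vars-signed : ∀ b → VarsAmong x A → VarsAmong x (signed b A)
  vars-signed true  va = va
  vars-signed false va = va

  vars-when : ∀ b → VarsAmong x A → VarsAmong x (A when b)
  vars-when true  va = va
  vars-when false _  = vars-⊥'

  vars-α : ∀ s → VarsAmong x (α s)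
  vars-α s = vars-⋀ {g = λ i → lit (digits s i) (x i)} λ i →
    vars-signed (isT (digits s i)) (i , refl) , vars-signed (isF (digits s i)) (i , refl)

  vars-χ : ∀ S s → VarsAmong x (χ S s)
  vars-χ S s = vars-α s , vars-⋀ {g = λ k → signed (S k) (◇ α k)} λ k → vars-signed (S k) (vars-α k)

  normalForm-vars : ∀ i → VarsAmong x (normalForm i)
  normalForm-vars i = vars-⋁ {g = λ j → χ-point j when bits i j} λ j →
    vars-when (bits i j) (uncurry vars-χ (point {3 ^ n} j))

mainTheorem14 : (n : ℕ) → 1 ≤ n → (x : Fin n → ℕ) → Injective _≡_ _≡_ x →
    Σ (Fin (count n) → Fm) λ f →
      ((i : Fin (count n)) → VarsAmong x (f i)) ×
      ((i j : Fin (count n)) → f i ≈ f j → i ≡ j) ×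
      ((φ : Fm) → VarsAmong x φ → ∃ λ i → φ ≈ f i)
mainTheorem14 n 1≤n x x-injective =
  normalForm , normalForm-vars , normalForm-injective , normalForm-complete
  where open Model x x-injective (fromℕ< 1≤n)
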